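{- The category $\mathbf{SupOMLatLin}$ has arbitrary dagger biproducts. Explicitly, for a family $(X_i)_{i\in I}$ of complete orthomodular lattices ($I$ any index set), $\bigoplus_{i\in I}X_i$ is the cartesian product $\prod_{i\in I}X_i$ of orthomodular lattices (componentwise order and orthocomplement), with coprojections $\kappa_j\colon X_j\to\bigoplus_{i\in I}X_i$ given by $\kappa_j(x)=x_{j=}$, where $x_{j=}(i)=x$ if $i=j$ and $x_{j=}(i)=0$ otherwise, with adjoints $\kappa_j^{*}((x_i)_{i\in I})=x_j$; the product projections are $p_j=\kappa_j^{*}$. That is, this is a coproduct in $\mathbf{SupOMLatLin}$, each $\kappa_j$ is a dagger monomorphism, and $\kappa_j^{*}\circ\kappa_i$ is the zero morphism for $i\neq j$.
   Context: An orthomodular lattice is a lattice with $0,1$ and an involutive, order-reversing orthocomplement $x\mapsto x^\perp$ with $x\wedge x^\perp=0$, satisfying $x\le y\Rightarrow y=x\vee(x^\perp\wedge y)$; complete means all joins exist. $x\perp y$ means $x\le y^\perp$. $\mathbf{SupOMLatLin}$ has complete orthomodular lattices as objects and linear maps as morphisms ($f\colon X\to Y$ admitting a unique $f^{*}\colon Y\to X$ with $f(x)\perp y$ iff $x\perp f^{*}(y)$), composition of functions, dagger $f\mapsto f^*$, zero object $\{0\}$ (zero morphisms are constant $0$). A dagger biproduct of a family $(A_i)$ in a dagger category with zero object is a coproduct with coprojections $\kappa_i$ that are dagger monomorphisms ($\kappa_i^*\circ\kappa_i=\mathrm{id}$) and satisfy $\kappa_j^{*}\circ\kappa_i=0$ for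 $i\ne j$. -}

module Defs where

open import Data.Product using (Σ; _×_; _,_; proj₁; proj₂)
open import Function.Bundles using (_⇔_; mk⇔; Equivalence)
open import Relation.Binary.PropositionalEquality using (_≡_; _≢_; subst)

record OMLData : Set₁ where
  infix 4 _≤_ _≈_ _⊥_
  infixr 7 _∧_
  infixr 6 _∨_
  field
    Carrier : Set
    _≤_     : Carrier → Carrier → Set
    𝟘 𝟙     : Carrier
    _∧_ _∨_ : Carrier → Carrier → Carrier
    _ᗮ      : Carrier → Carrier
    ⋁       : {J : Set} → (J → Carrier) → Carrier

  _≈_ : Carrier → Carrier → Set
  x ≈ y = (x ≤ y) × (y ≤ x)

  _⊥_ : Carrier → Carrier → Set
  x ⊥ y = x ≤ y ᗮ

record IsCompleteOML (D : OMLData) : Set₁ where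
  open OMLData D
  field
    ≤-refl       : ∀ {x} → x ≤ x
    ≤-trans      : ∀ {x y z} → x ≤ y → y ≤ z → x ≤ z
    𝟘-min        : ∀ x → 𝟘 ≤ x
    𝟙-max        : ∀ x → x ≤ 𝟙
    ∧-lb₁        : ∀ x y → x ∧ y ≤ x
    ∧-lb₂        : ∀ x y → x ∧ y ≤ y
    ∧-glb        : ∀ {x y z} → z ≤ x → z ≤ y → z ≤ x ∧ y
    ∨-ub₁        : ∀ x y → x ≤ x ∨ y
    ∨-ub₂        : ∀ x y → y ≤ x ∨ y
    ∨-lub        : ∀ {x y z} → x ≤ z → y ≤ z → x ∨ y ≤ z
    ᗮ-involutive : ∀ x → x ᗮ ᗮ ≈ x
    ᗮ-antitone   : ∀ {x y} → x ≤ y → y ᗮ ≤ x ᗮ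
    ᗮ-complement : ∀ x → x ∧ x ᗮ ≈ 𝟘
    orthomodular : ∀ {x y} → x ≤ y → y ≈ x ∨ (x ᗮ ∧ y)
    ⋁-ub         : ∀ {J : Set} (f : J → Carrier) (j : J) → f j ≤ ⋁ f
    ⋁-lub        : ∀ {J : Set} (f : J → Carrier) {z} → (∀ j → f j ≤ z) → ⋁ f ≤ z

record CompleteOML : Set₁ where
  field
    raw           : OMLData
    isCompleteOML : IsCompleteOML raw
  open OMLData raw public
  open IsCompleteOML isCompleteOML public

  ⊥-sym : ∀ {x y} → x ⊥ y → y ⊥ x
  ⊥-sym {x} {y} p = ≤-trans (proj₂ (ᗮ-involutive y)) (ᗮ-antitone p)

  𝟘-⊥ : ∀ x → 𝟘 ⊥ x
  𝟘-⊥ x = 𝟘-min (x ᗮ)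

  ⊥-𝟘 : ∀ x → x ⊥ 𝟘
  ⊥-𝟘 x = ⊥-sym (𝟘-⊥ x)

open CompleteOML using (Carrier)

IsAdjoint : (A B : CompleteOML) → (Carrier A → Carrier B) → (Carrier B → Carrier A) → Set
IsAdjoint A B f g = ∀ x y → CompleteOML._⊥_ B (f x) y ⇔ CompleteOML._⊥_ A x (g y)

record Linear (A B : CompleteOML) : Set where
  constructor mkLinear
  field
    fun     : Carrier A → Carrier B
    adj     : Carrier B → Carrier A
    adjoint : IsAdjoint A B fun adj
open Linear public

infix 4 _≈ₘ_
_≈ₘ_ : ∀ {A B} → Linear A B → Linear A B → Set
_≈ₘ_ {A} {B} f g = ∀ x → CompleteOML._≈_ B (fun f x) (fun g x)

private
  ⇔-trans : ∀ {P Q R : Set} → P ⇔ Q → Q ⇔ R → P ⇔ R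
  ⇔-trans p q = mk⇔ (λ x → Equivalence.to q (Equivalence.to p x))
                    (λ x → Equivalence.from p (Equivalence.from q x))

  ⇔-sym : ∀ {P Q : Set} → P ⇔ Q → Q ⇔ P
  ⇔-sym p = mk⇔ (Equivalence.from p) (Equivalence.to p)

idL : ∀ {A} → Linear A A
idL = mkLinear (λ x → x) (λ x → x) (λ x y → mk⇔ (λ p → p) (λ p → p))

infixr 9 _∘L_
_∘L_ : ∀ {A B C} → Linear B C → Linear A B → Linear A C
g ∘L f = mkLinear (λ x → fun g (fun f x)) (λ z → adj f (adj g z))
  (λ x z → ⇔-trans (adjoint g (fun f x) z) (adjoint f x (adj g z)))

_† : ∀ {A B} → Linear A B → Linear B A
_† {A} {B} f = mkLinear (adj f) (fun f) (λ y x →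
  ⇔-trans (mk⇔ (CompleteOML.⊥-sym A) (CompleteOML.⊥-sym A))
  (⇔-trans (⇔-sym (adjoint f x y))
           (mk⇔ (CompleteOML.⊥-sym B) (CompleteOML.⊥-sym B))))

zeroL : ∀ {A B} → Linear A B
zeroL {A} {B} = mkLinear (λ _ → CompleteOML.𝟘 B) (λ _ → CompleteOML.𝟘 A)
  (λ x y → mk⇔ (λ _ → CompleteOML.⊥-𝟘 A x) (λ _ → CompleteOML.𝟘-⊥ B y))

module _ {I : Set} (X : I → CompleteOML) where

  IsCoproduct : (P : CompleteOML) → ((i : I) → Linear (X i) P) → Set₁
  IsCoproduct P κ =
    (Y : CompleteOML) (f : (i : I) → Linear (X i) Y) →
    Σ (Linear P Y) λ h →
      ((i : I) → h ∘L κ i ≈ₘ f i) ×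
      ((h' : Linear P Y) → ((i : I) → h' ∘L κ i ≈ₘ f i) → h' ≈ₘ h)

  IsDaggerBiproduct : (P : CompleteOML) → ((i : I) → Linear (X i) P) → Set₁
  IsDaggerBiproduct P κ =
    IsCoproduct P κ ×
    ((i : I) → (κ i) † ∘L κ i ≈ₘ idL) ×
    ((i j : I) → i ≢ j → (κ j) † ∘L κ i ≈ₘ zeroL)

  productRaw : OMLData
  productRaw = record
    { Carrier = (i : I) → Carrier (X i)
    ; _≤_ = λ x y → (i : I) → CompleteOML._≤_ (X i) (x i) (y i)
    ; 𝟘 = λ i → CompleteOML.𝟘 (X i)
    ; 𝟙 = λ i → CompleteOML.𝟙 (X i)
    ; _∧_ = λ x y i → CompleteOML._∧_ (X i) (x i) (y i)
    ; _∨_ = λ x y i → CompleteOML._∨_ (X i) (x i) (y i)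
    ; _ᗮ = λ x i → CompleteOML._ᗮ (X i) (x i)
    ; ⋁ = λ f i → CompleteOML.⋁ (X i) (λ j → f j i)
    }

  ⨁ : IsCompleteOML productRaw → CompleteOML
  ⨁ isP = record { raw = productRaw ; isCompleteOML = isP }

  -- Written constructively (no decidable equality on I) as the join
  -- over all proofs p : j ≡ i of x transported along p; this is x when
  -- i = j and the empty join 0 when i ≠ j.
  inj : (j : I) → Carrier (X j) → (i : I) → Carrier (X i)
  inj j x i = CompleteOML.⋁ (X i) {J = j ≡ i} (λ p → subst (λ k → Carrier (X k)) p x)

  proj : (j : I) → ((i : I) → Carrier (X i)) → Carrier (X j)
  proj j x = x j

-- A linear map f is a left adjoint in the order-theoretic sense, since
-- f x ≤ z iff x ⊥ f*(zᗮ); hence it is monotone and preserves all joins.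
-- In the componentwise product every x is the join of the x_{i=}, so a
-- linear map out of the product is determined by its composites with
-- the κ_i, and the copairing of (f_i) is x ↦ ⋁_i f_i(x_i), with adjoint
-- y ↦ (f_i*(y))_i.
module Submission where

open import Defs
open import Data.Empty using (⊥-elim)
open import Data.Product using (Σ; _,_; proj₁; proj₂)
open import Function.Bundles using (_⇔_; mk⇔; Equivalence)
open import Level using (0ℓ)
open import Relation.Binary.Bundles using (Poset)
open import Relation.Binary.PropositionalEquality using (_≢_; refl; subst)
import Relation.Binary.Reasoning.PartialOrder as PosetReasoning

module CompleteOMLProperties (A : CompleteOML) where
  open CompleteOML A

  poset : Poset 0ℓ 0ℓ 0ℓ
  poset = record
    { Carrier        = Carrier
    ; _≈_            = _≈_
    ; _≤_            = _≤_
    ; isPartialOrder = record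
      { isPreorder = record
        { isEquivalence = record
          { refl  = ≤-refl , ≤-refl
          ; sym   = λ (p , q) → q , p
          ; trans = λ (p , q) (r , s) → ≤-trans p r , ≤-trans s q
          }
        ; reflexive = proj₁
        ; trans     = ≤-trans
        }
      ; antisym = _,_
      }
    }

  ⋁-mono : ∀ {J : Set} {f g : J → Carrier} → (∀ j → f j ≤ g j) → ⋁ f ≤ ⋁ g
  ⋁-mono {g = g} f≤g = ⋁-lub _ λ j → ≤-trans (f≤g j) (⋁-ub g j)

  ⋁-cong : ∀ {J : Set} {f g : J → Carrier} → (∀ j → f j ≈ g j) → ⋁ f ≈ ⋁ g
  ⋁-cong f≈g = ⋁-mono (λ j → proj₁ (f≈g j)) , ⋁-mono (λ j → proj₂ (f≈g j))

module LinearProperties {A B : CompleteOML} (f : Linear A B) where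
  private
    module A = CompleteOML A
    module B = CompleteOML B

  fun-≤⇔⊥-adj : ∀ {x z} → B._≤_ (fun f x) z ⇔ A._⊥_ x (adj f (B._ᗮ z))
  fun-≤⇔⊥-adj {x} {z} = mk⇔
    (λ fx≤z → Equivalence.to (adjoint f x (B._ᗮ z))
                (B.≤-trans fx≤z (proj₂ (B.ᗮ-involutive z))))
    (λ x⊥ → B.≤-trans (Equivalence.from (adjoint f x (B._ᗮ z)) x⊥)
                (proj₁ (B.ᗮ-involutive z)))

  fun-mono : ∀ {x y} → A._≤_ x y → B._≤_ (fun f x) (fun f y)
  fun-mono x≤y = Equivalence.from fun-≤⇔⊥-adj
    (A.≤-trans x≤y (Equivalence.to fun-≤⇔⊥-adj B.≤-refl))

  fun-cong : ∀ {x y} → A._≈_ x y → B._≈_ (fun f x) (fun f y)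
  fun-cong (x≤y , y≤x) = fun-mono x≤y , fun-mono y≤x

  fun-⋁-lub : ∀ {J : Set} (a : J → A.Carrier) {z} →
              (∀ j → B._≤_ (fun f (a j)) z) → B._≤_ (fun f (A.⋁ a)) z
  fun-⋁-lub a fa≤z = Equivalence.from fun-≤⇔⊥-adj
    (A.⋁-lub a λ j → Equivalence.to fun-≤⇔⊥-adj (fa≤z j))

  fun-⋁ : ∀ {J : Set} (a : J → A.Carrier) →
          B._≈_ (fun f (A.⋁ a)) (B.⋁ (λ j → fun f (a j)))
  fun-⋁ a = fun-⋁-lub a (B.⋁-ub _)
          , B.⋁-lub _ (λ j → fun-mono (A.⋁-ub a j))

module _ {I : Set} (X : I → CompleteOML) where
  private
    module X (i : I) = CompleteOML (X i)

  productIsCompleteOML : IsCompleteOML (productRaw X)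
  productIsCompleteOML = record
    { ≤-refl       = λ i → X.≤-refl i
    ; ≤-trans      = λ p q i → X.≤-trans i (p i) (q i)
    ; 𝟘-min        = λ x i → X.𝟘-min i (x i)
    ; 𝟙-max        = λ x i → X.𝟙-max i (x i)
    ; ∧-lb₁        = λ x y i → X.∧-lb₁ i (x i) (y i)
    ; ∧-lb₂        = λ x y i → X.∧-lb₂ i (x i) (y i)
    ; ∧-glb        = λ p q i → X.∧-glb i (p i) (q i)
    ; ∨-ub₁        = λ x y i → X.∨-ub₁ i (x i) (y i)
    ; ∨-ub₂        = λ x y i → X.∨-ub₂ i (x i) (y i)
    ; ∨-lub        = λ p q i → X.∨-lub i (p i) (q i)
    ; ᗮ-involutive = λ x → pointwise (λ i → X.ᗮ-involutive i (x i))
    ; ᗮ-antitone   = λ p i → X.ᗮ-antitone i (p i)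
    ; ᗮ-complement = λ x → pointwise (λ i → X.ᗮ-complement i (x i))
    ; orthomodular = λ p → pointwise (λ i → X.orthomodular i (p i))
    ; ⋁-ub         = λ f j i → X.⋁-ub i (λ j → f j i) j
    ; ⋁-lub        = λ f h i → X.⋁-lub i (λ j → f j i) (λ j → h j i)
    }
    where
    pointwise : ∀ {x y : (i : I) → X.Carrier i} →
                (∀ i → X._≈_ i (x i) (y i)) → OMLData._≈_ (productRaw X) x y
    pointwise x≈y = (λ i → proj₁ (x≈y i)) , (λ i → proj₂ (x≈y i))

  ∏ : CompleteOML
  ∏ = ⨁ X productIsCompleteOML

  private
    module ∏ = CompleteOML ∏

  inj-≤⇔ : ∀ j {x z} → ∏._≤_ (inj X j x) z ⇔ X._≤_ j x (z j)
  inj-≤⇔ j {x} {z} = mk⇔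
    (λ inj≤z → X.≤-trans j (X.⋁-ub j (λ p → subst X.Carrier p x) refl) (inj≤z j))
    (λ x≤zj i → X.⋁-lub i _ λ { refl → x≤zj })

  inj-adjoint : ∀ j → IsAdjoint (X j) ∏ (inj X j) (proj X j)
  inj-adjoint j x y = inj-≤⇔ j

  κ : (j : I) → Linear (X j) ∏
  κ j = mkLinear (inj X j) (proj X j) (inj-adjoint j)

  inj-self : ∀ j x → X._≈_ j (inj X j x j) x
  inj-self j x = X.⋁-lub j _ (λ { refl → X.≤-refl j })
               , Equivalence.to (inj-≤⇔ j) ∏.≤-refl

  inj-apart : ∀ {i j} → i ≢ j → ∀ x → X._≈_ j (inj X i x j) (X.𝟘 j)
  inj-apart i≢j x = X.⋁-lub _ _ (λ i≡j → ⊥-elim (i≢j i≡j)) , X.𝟘-min _ _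

  ⋁-inj : ∀ x → ∏._≈_ x (∏.⋁ (λ i → inj X i (x i)))
  ⋁-inj x = (λ k → X.≤-trans k (proj₂ (inj-self k (x k)))
                              (X.⋁-ub k (λ i → inj X i (x i) k) k))
          , ∏.⋁-lub _ (λ i → Equivalence.from (inj-≤⇔ i) (X.≤-refl i))

  module _ {Y : CompleteOML} (f : (i : I) → Linear (X i) Y) where
    private
      module Y = CompleteOML Y
    open LinearProperties

    copair : Linear ∏ Y
    copair = mkLinear (λ x → Y.⋁ (λ i → fun (f i) (x i))) (λ y i → adj (f i) y)
      λ x y → mk⇔
        (λ ⋁fx⊥y i → Equivalence.to (adjoint (f i) (x i) y)
                       (Y.≤-trans (Y.⋁-ub _ i) ⋁fx⊥y))
        (λ x⊥f*y → Y.⋁-lub _ λ i → Equivalence.from (adjoint (f i) (x i) y) (x⊥f*y i))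

    copair-κ : ∀ i → copair ∘L κ i ≈ₘ f i
    copair-κ i x =
        Y.⋁-lub _ (λ k → fun-⋁-lub (f k) _ λ { refl → Y.≤-refl })
      , Y.≤-trans (fun-mono (f i) (proj₂ (inj-self i x))) (Y.⋁-ub _ i)

    copair-unique : (h : Linear ∏ Y) → (∀ i → h ∘L κ i ≈ₘ f i) → h ≈ₘ copair
    copair-unique h h∘κ≈f x = begin-equality
      fun h x                                 ≈⟨ fun-cong h (⋁-inj x) ⟩
      fun h (∏.⋁ (λ i → inj X i (x i)))       ≈⟨ fun-⋁ h _ ⟩
      Y.⋁ (λ i → fun h (inj X i (x i)))       ≈⟨ ⋁-cong (λ i → h∘κ≈f i (x i)) ⟩
      Y.⋁ (λ i → fun (f i) (x i))             ∎
      where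
      open CompleteOMLProperties Y
      open PosetReasoning poset

  κ-isCoproduct : IsCoproduct X ∏ κ
  κ-isCoproduct Y f = copair f , copair-κ f , copair-unique f

  κ-daggerMono : ∀ i → κ i † ∘L κ i ≈ₘ idL
  κ-daggerMono = inj-self

  κ-orthogonal : ∀ i j → i ≢ j → κ j † ∘L κ i ≈ₘ zeroL
  κ-orthogonal i j = inj-apart

proposition17 : (I : Set) (X : I → CompleteOML) →
    Σ (IsCompleteOML (productRaw X)) λ isP →
    Σ ((j : I) → IsAdjoint (X j) (⨁ X isP) (inj X j) (proj X j)) λ adjκ →
    IsDaggerBiproduct X (⨁ X isP) (λ j → mkLinear (inj X j) (proj X j) (adjκ j))
proposition17 I X = productIsCompleteOML X
                  , inj-adjoint X
                  , κ-isCoproduct X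
                  , κ-daggerMono X
                  , κ-orthogonal X
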